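{- For $k \ge 4$, let $T_{III_k}$ be the $(k-1)\times k$ binary matrix in which, for $i=1,\dots,k-2$, row $i$ has 1 entries exactly in columns $i$ and $i+1$, and row $k-1$ has 1 entries exactly in columns $2,3,\dots,k-2$ and $k$ (and 0 entries in columns $1$ and $k-1$). Then the smallest odd cycle in the incompatibility graph of $T_{III_k}$ has length $k+2$ if $k$ is odd and $k+3$ if $k$ is even.
   Context: For an $m\times n$ binary matrix $M$ with columns $c_1,\dots,c_n$, the incompatibility graph $G_M$ is the undirected graph whose vertices are the ordered pairs $(c_i,c_j)$ with $i\neq j$, and in which two vertices of the form $(c_i,c_j)$ and $(c_j,c_k)$ are adjacent if either $c_i=c_k$, or there is a row $r_l$ of $M$ with $M_{li}=M_{lk}=1$ and $M_{lj}=0$. -}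

module Defs where

open import Data.Bool using (Bool; true; false; if_then_else_; _∨_; _∧_)
open import Data.Nat using (ℕ; zero; suc; _+_; _*_; _∸_; _≤_; _<ᵇ_; _≡ᵇ_; _≤ᵇ_)
open import Data.Fin using (Fin; toℕ)
open import Data.Product using (Σ; ∃; _×_; _,_)
open import Data.Sum using (_⊎_)
open import Relation.Binary.PropositionalEquality using (_≡_; _≢_)
open import Function.Definitions using (Injective)

Odd : ℕ → Set
Odd n = ∃ λ m → n ≡ suc (2 * m)

Even : ℕ → Set
Even n = ∃ λ m → n ≡ 2 * m

BinMatrix : ℕ → ℕ → Set
BinMatrix m n = Fin m → Fin n → Bool

-- Columns are 0-indexed here: paper column c corresponds to index c - 1,
-- paper row r corresponds to index r - 1.
-- Row i (0 ≤ i ≤ k-3): ones exactly in columns i and i+1.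
-- Row k-2 (the last row): ones exactly in columns 1,…,k-3 and k-1.
T-III : (k : ℕ) → BinMatrix (k ∸ 1) k
T-III k r c =
  if toℕ r <ᵇ (k ∸ 2)
  then ((toℕ c ≡ᵇ toℕ r) ∨ (toℕ c ≡ᵇ suc (toℕ r)))
  else (((1 ≤ᵇ toℕ c) ∧ (toℕ c <ᵇ (k ∸ 2))) ∨ (toℕ c ≡ᵇ (k ∸ 1)))

IsVertex : {n : ℕ} → Fin n × Fin n → Set
IsVertex (i , j) = i ≢ j

IncompRel : {m n : ℕ} → BinMatrix m n → Fin n × Fin n → Fin n × Fin n → Set
IncompRel {m} M (i , j) (j' , k) =
  j ≡ j' × (i ≡ k ⊎ Σ (Fin m) λ l → M l i ≡ true × M l k ≡ true × M l j ≡ false)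

Adj : {m n : ℕ} → BinMatrix m n → Fin n × Fin n → Fin n × Fin n → Set
Adj M u v = IncompRel M u v ⊎ IncompRel M v u

Cycle : {m n : ℕ} → BinMatrix m n → ℕ → Set
Cycle {m} {n} M L =
  3 ≤ L ×
  Σ (Fin L → Fin n × Fin n) λ v →
    (∀ a → IsVertex (v a)) ×
    Injective _≡_ _≡_ v ×
    (∀ (a b : Fin L) →
       (suc (toℕ a) ≡ toℕ b ⊎ (suc (toℕ a) ≡ L × toℕ b ≡ 0)) →
       Adj M (v a) (v b))

OddCycle : {m n : ℕ} → BinMatrix m n → ℕ → Set
OddCycle M L = Odd L × Cycle M L

SmallestOddCycleLength : {m n : ℕ} → BinMatrix m n → ℕ → Set
SmallestOddCycleLength M L = OddCycle M L × (∀ L' → OddCycle M L' → L ≤ L')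

-- Write k = 4 + P and let N = k + 1 = 5 + P if k is odd, N = k + 2 = 6 + P if k
-- is even (`LadderSize P N`).  The smallest odd cycle has length N + 1.
--
-- In the Möbius ladder of order 2N (residues mod 2N, x joined to
-- x ± 1 and to its antipode x + N), a closed walk with p forward, q backward and
-- s antipodal steps satisfies q ≡ p + s·N (mod 2N), which is impossible when
-- p + q + s is odd and at most N.  Hence any map from the vertices of G_M to the
-- ladder sending incompatible pairs to edges forces every odd cycle of G_M to be
-- longer than N.  We build such a map h for T_{III_k}, checking it row by row on
-- the incompatibilities of T_{III_k} (path rows {ρ, ρ+1} and the last row).
--
-- An explicit cycle of length N + 1: a zigzag between the last
-- column and the columns 0, …, k-2 along the path rows, closed up through the
-- last row.

module Submission where

open import Defs
open import Data.Bool using (Bool; true; false; if_then_else_; not; _∨_; _∧_)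
open import Data.Bool.Properties using (T-≡; ¬-not; ∨-zeroʳ; not-involutive)
open import Data.Nat using (ℕ; zero; suc; pred; _+_; _*_; _∸_; _≤_; _<_; _<ᵇ_; _≡ᵇ_; _≤ᵇ_; z≤n; s≤s; NonZero; >-nonZero; >-nonZero⁻¹; _≟_; _<?_)
open import Data.Nat.Properties
open import Data.Nat.DivMod using (_%_; _/_; %-distribˡ-+; [m+kn]%n≡m%n; [m+n]%n≡m%n; m<n⇒m%n≡m; m%n<n; m≡m%n+[m/n]*n; n%n≡0)
open import Data.Nat.Tactic.RingSolver using (solve-∀; solve)
open import Data.List using (_∷_; [])
open import Data.Fin using (Fin; toℕ; fromℕ<)
open import Data.Fin.Properties using (toℕ<n; toℕ-fromℕ<; toℕ-injective)
open import Data.Product using (_×_; _,_; proj₁; proj₂)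
open import Data.Sum using (_⊎_; inj₁; inj₂)
open import Function using (_∘_)
open import Function.Bundles using (Equivalence)
open import Level using (0ℓ)
open import Relation.Nullary using (¬_; yes; no; contradiction)
open import Relation.Binary.Bundles using (Setoid)
open import Relation.Binary.Definitions using (tri<; tri≈; tri>)
open import Relation.Binary.PropositionalEquality
open import Relation.Binary.Structures using (IsEquivalence)
import Relation.Binary.Reasoning.Setoid as SetoidReasoning

open Equivalence using (to; from)

≡ᵇ-sound : ∀ {m n} → (m ≡ᵇ n) ≡ true → m ≡ n
≡ᵇ-sound {m} {n} e = ≡ᵇ⇒≡ m n (from T-≡ e)

≡ᵇ-refl : ∀ n → (n ≡ᵇ n) ≡ true
≡ᵇ-refl n = to T-≡ (≡⇒≡ᵇ n n refl)

≢⇒≡ᵇ-false : ∀ {m n} → m ≢ n → (m ≡ᵇ n) ≡ false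
≢⇒≡ᵇ-false m≢n = ¬-not (λ e → m≢n (≡ᵇ-sound e))

<⇒<ᵇ-true : ∀ {m n} → m < n → (m <ᵇ n) ≡ true
<⇒<ᵇ-true m<n = to T-≡ (<⇒<ᵇ m<n)

≥⇒<ᵇ-false : ∀ {m n} → n ≤ m → (m <ᵇ n) ≡ false
≥⇒<ᵇ-false {m} {n} n≤m = ¬-not (λ e → <⇒≱ (<ᵇ⇒< m n (from T-≡ e)) n≤m)

even-or-odd : ∀ n → Even n ⊎ Odd n
even-or-odd zero = inj₁ (0 , refl)
even-or-odd (suc n) with even-or-odd n
... | inj₁ (m , refl) = inj₂ (m , refl)
... | inj₂ (m , refl) = inj₁ (suc m , cong suc (sym (+-suc m (m + 0))))

even : ℕ → Bool
even zero    = true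
even (suc n) = not (even n)

even-2+ : ∀ n → even (2 + n) ≡ even n
even-2+ n = not-involutive (even n)

even-double : ∀ m → even (2 * m) ≡ true
even-double zero    = refl
even-double (suc m) = trans (cong even (regroup m)) (trans (even-2+ (2 * m)) (even-double m))
  where
  regroup : ∀ m → 2 * suc m ≡ 2 + 2 * m
  regroup = solve-∀

even-4+ : ∀ n → even (4 + n) ≡ even n
even-4+ n = trans (even-2+ (2 + n)) (even-2+ n)

even-true : ∀ {n} → Even n → even n ≡ true
even-true (m , refl) = even-double m

even-false : ∀ {n} → Odd n → even n ≡ false
even-false (m , refl) = cong not (even-double m)

odd+2 : ∀ {n} → Odd n → Odd (2 + n)
odd+2 (m , refl) = suc m , cong suc (regroup m)
  where
  regroup : ∀ m → 2 + 2 * m ≡ 2 * suc m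
  regroup = solve-∀

even+3 : ∀ {n} → Even n → Odd (3 + n)
even+3 (m , refl) = odd+2 (m , refl)

module Modulo (M : ℕ) .{{_ : NonZero M}} where

  infix 4 _≋_
  record _≋_ (x y : ℕ) : Set where
    constructor same-remainder
    field remainder : x % M ≡ y % M

  ≋-isEquivalence : IsEquivalence _≋_
  ≋-isEquivalence = record
    { refl  = same-remainder refl
    ; sym   = λ (same-remainder e) → same-remainder (sym e)
    ; trans = λ (same-remainder e) (same-remainder e′) → same-remainder (trans e e′)
    }

  open IsEquivalence ≋-isEquivalence public
    using () renaming (refl to ≋-refl; sym to ≋-sym; trans to ≋-trans)

  ≋-setoid : Setoid 0ℓ 0ℓ
  ≋-setoid = record { isEquivalence = ≋-isEquivalence }

  module ≋-Reasoning = SetoidReasoning ≋-setoid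

  ≡⇒≋ : ∀ {x y} → x ≡ y → x ≋ y
  ≡⇒≋ e = same-remainder (cong (_% M) e)

  ≋-+ˡ : ∀ c {x y} → x ≋ y → c + x ≋ c + y
  ≋-+ˡ c {x} {y} (same-remainder e) = same-remainder (begin
    (c + x) % M           ≡⟨ %-distribˡ-+ c x M ⟩
    (c % M + x % M) % M   ≡⟨ cong (λ r → (c % M + r) % M) e ⟩
    (c % M + y % M) % M   ≡⟨ %-distribˡ-+ c y M ⟨
    (c + y) % M           ∎)
    where open ≡-Reasoning

  ≋-+ʳ : ∀ c {x y} → x ≋ y → x + c ≋ y + c
  ≋-+ʳ c {x} {y} e = subst₂ _≋_ (+-comm c x) (+-comm c y) (≋-+ˡ c e)

  +kM≋ : ∀ x k → x + k * M ≋ x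
  +kM≋ x k = same-remainder ([m+kn]%n≡m%n x k M)

  +M≋ : ∀ x → x + M ≋ x
  +M≋ x = same-remainder ([m+n]%n≡m%n x M)

  -- Cancellation rests on (M ∸ h % M) + h being a multiple of M.
  complement-multiple : ∀ h → (M ∸ h % M) + h ≡ suc (h / M) * M
  complement-multiple h = begin
    (M ∸ h % M) + h                    ≡⟨ cong ((M ∸ h % M) +_) (m≡m%n+[m/n]*n h M) ⟩
    (M ∸ h % M) + (h % M + h / M * M)  ≡⟨ +-assoc (M ∸ h % M) (h % M) _ ⟨
    (M ∸ h % M) + h % M + h / M * M    ≡⟨ cong (_+ h / M * M) (m∸n+n≡m (<⇒≤ (m%n<n h M))) ⟩
    M + h / M * M                      ∎
    where open ≡-Reasoning

  ≋-cancelˡ : ∀ h {x y} → h + x ≋ h + y → x ≋ y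
  ≋-cancelˡ h {x} {y} e = begin
    x                     ≈⟨ complement x ⟨
    c + (h + x)           ≈⟨ ≋-+ˡ c e ⟩
    c + (h + y)           ≈⟨ complement y ⟩
    y                     ∎
    where
    open ≋-Reasoning
    c : ℕ
    c = M ∸ h % M
    complement : ∀ z → c + (h + z) ≋ z
    complement z = begin
      c + (h + z)                    ≡⟨ trans (sym (+-assoc c h z)) (+-comm (c + h) z) ⟩
      z + (c + h)                    ≡⟨ cong (z +_) (complement-multiple h) ⟩
      z + suc (h / M) * M            ≈⟨ +kM≋ z (suc (h / M)) ⟩
      z                              ∎

  ≋-small : ∀ {x y} → x < M → y < M → x ≋ y → x ≡ y
  ≋-small x<M y<M (same-remainder e) = trans (sym (m<n⇒m%n≡m x<M)) (trans e (m<n⇒m%n≡m y<M))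

module MöbiusLadder (N : ℕ) .{{_ : NonZero N}} where

  instance
    N+N≢0 : NonZero (N + N)
    N+N≢0 = >-nonZero (<-≤-trans (>-nonZero⁻¹ N) (m≤m+n N N))

  open Modulo (N + N) public

  data Edge (x y : ℕ) : Set where
    forward   : y ≋ suc x → Edge x y
    backward  : x ≋ suc y → Edge x y
    antipodal : y ≋ x + N → Edge x y

  +N+N≋ : ∀ x → x + N + N ≋ x
  +N+N≋ x = ≋-trans (≡⇒≋ (+-assoc x N N)) (+M≋ x)

  Edge-sym : ∀ {x y} → Edge x y → Edge y x
  Edge-sym (forward e)   = backward e
  Edge-sym (backward e)  = forward e
  Edge-sym (antipodal e) = antipodal (≋-trans (≋-sym (+N+N≋ _)) (≋-+ʳ N (≋-sym e)))

  Edge-resp : ∀ {x x′ y y′} → x ≋ x′ → y ≋ y′ → Edge x y → Edge x′ y′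
  Edge-resp x≋x′ y≋y′ (forward e) =
    forward (≋-trans (≋-sym y≋y′) (≋-trans e (≋-+ˡ 1 x≋x′)))
  Edge-resp x≋x′ y≋y′ (backward e) =
    backward (≋-trans (≋-sym x≋x′) (≋-trans e (≋-+ˡ 1 y≋y′)))
  Edge-resp x≋x′ y≋y′ (antipodal e) =
    antipodal (≋-trans (≋-sym y≋y′) (≋-trans e (≋-+ʳ N x≋x′)))

  Edge-+N : ∀ {x y} → Edge x y → Edge (x + N) (y + N)
  Edge-+N (forward e)   = forward (≋-+ʳ N e)
  Edge-+N (backward e)  = backward (≋-+ʳ N e)
  Edge-+N (antipodal e) = antipodal (≋-+ʳ N e)

  record Winding (x y len : ℕ) : Set where
    constructor winding
    field
      p q s   : ℕ
      counts  : p + q + s ≡ len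
      balance : y + q ≋ x + p + s * N

  winding-step : ∀ {x y z len} → Winding x y len → Edge y z → Winding x z (suc len)
  winding-step {x} {y} {z} (winding p q s counts balance) (forward e) = record
    { p = suc p ; q = q ; s = s ; counts = cong suc counts
    ; balance = begin
        z + q                  ≈⟨ ≋-+ʳ q e ⟩
        suc y + q              ≈⟨ ≋-+ˡ 1 balance ⟩
        suc (x + p + s * N)    ≡⟨ solve (x ∷ p ∷ s ∷ N ∷ []) ⟩
        x + suc p + s * N      ∎ }
    where open ≋-Reasoning
  winding-step {x} {y} {z} (winding p q s counts balance) (backward e) = record
    { p = p ; q = suc q ; s = s ; counts = trans (cong (_+ s) (+-suc p q)) (cong suc counts)
    ; balance = begin
        z + suc q              ≡⟨ +-suc z q ⟩
        suc z + q              ≈⟨ ≋-+ʳ q e ⟨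
        y + q                  ≈⟨ balance ⟩
        x + p + s * N          ∎ }
    where open ≋-Reasoning
  winding-step {x} {y} {z} (winding p q s counts balance) (antipodal e) = record
    { p = p ; q = q ; s = suc s ; counts = trans (+-suc (p + q) s) (cong suc counts)
    ; balance = begin
        z + q                  ≈⟨ ≋-+ʳ q e ⟩
        y + N + q              ≡⟨ solve (y ∷ N ∷ q ∷ []) ⟩
        y + q + N              ≈⟨ ≋-+ʳ N balance ⟩
        x + p + s * N + N      ≡⟨ solve (x ∷ p ∷ s ∷ N ∷ []) ⟩
        x + p + suc s * N      ∎ }
    where open ≋-Reasoning

  below-2N : ∀ {x} → x ≤ N → x < N + N
  below-2N x≤N = <-≤-trans (s≤s x≤N) (≤-trans (≤-reflexive (+-comm 1 N)) (+-monoʳ-≤ N (>-nonZero⁻¹ N)))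

  antipodes-even : ∀ p s′ → p + 2 * s′ * N ≋ p
  antipodes-even p s′ = ≋-trans (≡⇒≋ (regroup p s′ N)) (+kM≋ p s′)
    where
    regroup : ∀ a b n → a + 2 * b * n ≡ a + b * (n + n)
    regroup = solve-∀

  antipodes-odd : ∀ p s′ → p + suc (2 * s′) * N ≋ p + N
  antipodes-odd p s′ = ≋-trans (≡⇒≋ (regroup p s′ N)) (antipodes-even (p + N) s′)
    where
    regroup : ∀ a b n → a + suc (2 * b) * n ≡ a + n + 2 * b * n
    regroup = solve-∀

  -- With an even number 2s′ of antipodal steps, balance forces q = p (both are
  -- below 2N), so the length p + q + 2s′ is even.
  even-antipodes-balance : ∀ {p q} s′ → p ≤ N → q ≤ N → q ≋ p + 2 * s′ * N → Even (p + q + 2 * s′)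
  even-antipodes-balance {p} {q} s′ p≤N q≤N q≋ = p + s′ , (begin
    p + q + 2 * s′        ≡⟨ cong (λ t → p + t + 2 * s′) q≡p ⟩
    p + p + 2 * s′        ≡⟨ solve (p ∷ s′ ∷ []) ⟩
    2 * (p + s′)          ∎)
    where
    open ≡-Reasoning
    q≡p : q ≡ p
    q≡p = ≋-small (below-2N q≤N) (below-2N p≤N) (≋-trans q≋ (antipodes-even p s′))

  -- With an odd number of antipodal steps, balance forces q = p + N ≥ N.
  odd-antipodes-balance : ∀ {p q} s′ → p < N → q ≤ N → q ≋ p + suc (2 * s′) * N → N ≤ q
  odd-antipodes-balance {p} s′ p<N q≤N q≋ = ≤-trans (m≤n+m N p) (≤-reflexive (sym
    (≋-small (below-2N q≤N) (+-monoˡ-< N p<N) (≋-trans q≋ (antipodes-odd p s′)))))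

  short-odd-walk-unbalanced : ∀ {p q s L} → p + q + s ≡ L → Odd L → L ≤ N →
                              ¬ (q ≋ p + s * N)
  short-odd-walk-unbalanced {p} {q} {s} refl (m , L-odd) L≤N q≋ with even-or-odd s
  ... | inj₁ (s′ , refl) =
          let (n , L-even) = even-antipodes-balance s′ p≤N q≤N q≋ in even≢odd n m (trans (sym L-even) L-odd)
    where
    p≤N : p ≤ N
    p≤N = ≤-trans (m≤m+n p q) (≤-trans (m≤m+n (p + q) (2 * s′)) L≤N)
    q≤N : q ≤ N
    q≤N = ≤-trans (m≤n+m q p) (≤-trans (m≤m+n (p + q) (2 * s′)) L≤N)
  ... | inj₂ (s′ , refl) = <-irrefl refl (<-≤-trans q<N (odd-antipodes-balance s′ p<N (<⇒≤ q<N) q≋))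
    where
    q+s≤N : q + suc (2 * s′) ≤ N
    q+s≤N = ≤-trans (m≤n+m (q + suc (2 * s′)) p) (≤-trans (≤-reflexive (sym (+-assoc p q _))) L≤N)
    q<N : q < N
    q<N = <-≤-trans (m<m+n q (s≤s z≤n)) q+s≤N
    p<N : p < N
    p<N = <-≤-trans (m<m+n p (<-≤-trans (s≤s z≤n) (m≤n+m _ q))) (≤-trans (≤-reflexive (sym (+-assoc p q _))) L≤N)

  odd-closed-walk-long : ∀ L (f : ℕ → ℕ) → (∀ t → t < L → Edge (f t) (f (suc t))) →
                         f L ≡ f 0 → Odd L → N < L
  odd-closed-walk-long L f steps closed L-odd with N <? L
  ... | yes N<L = N<L
  ... | no N≮L = contradiction closed-balance (short-odd-walk-unbalanced {p} {q} {s} counts L-odd (≮⇒≥ N≮L))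
    where
    wound : ∀ t → t ≤ L → Winding (f 0) (f t) t
    wound zero    _   = winding 0 0 0 refl (≡⇒≋ (cong (_+ 0) (sym (+-identityʳ (f 0)))))
    wound (suc t) t<L = winding-step (wound t (<⇒≤ t<L)) (steps t t<L)
    open Winding (wound L ≤-refl)
    closed-balance : q ≋ p + s * N
    closed-balance = ≋-cancelˡ (f 0) (begin
      f 0 + q               ≡⟨ cong (_+ q) (sym closed) ⟩
      f L + q               ≈⟨ balance ⟩
      f 0 + p + s * N       ≡⟨ +-assoc (f 0) p (s * N) ⟩
      f 0 + (p + s * N)     ∎)
      where open ≋-Reasoning

module CyclicIndex (L : ℕ) .{{_ : NonZero L}} where

  position : ℕ → Fin L
  position t = fromℕ< (m%n<n t L)

  toℕ-position : ∀ t → toℕ (position t) ≡ t % L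
  toℕ-position t = toℕ-fromℕ< (m%n<n t L)

  consecutive : ∀ {t} → t < L →
    suc (toℕ (position t)) ≡ toℕ (position (suc t)) ⊎
    (suc (toℕ (position t)) ≡ L × toℕ (position (suc t)) ≡ 0)
  consecutive {t} t<L
    rewrite toℕ-position t | toℕ-position (suc t) | m<n⇒m%n≡m t<L with m≤n⇒m<n∨m≡n t<L
  ... | inj₁ t+1<L = inj₁ (sym (m<n⇒m%n≡m t+1<L))
  ... | inj₂ refl  = inj₂ (refl , n%n≡0 L)

  position-L : position L ≡ position 0
  position-L = toℕ-injective (trans (toℕ-position L) (trans (n%n≡0 L) (sym (trans (toℕ-position 0) (m<n⇒m%n≡m (>-nonZero⁻¹ L))))))

-- A map H from the vertices of G_M to the Möbius ladder of order 2N that sends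
-- incompatible pairs to edges forces every odd cycle of G_M to be longer than N:
-- the images of the cycle's vertices form an odd closed walk in the ladder.
odd-cycle-longer-than : ∀ {m n} (M : BinMatrix m n) (N : ℕ) .{{_ : NonZero N}} →
  (H : Fin n × Fin n → ℕ) →
  (∀ u v → IsVertex u → IsVertex v → IncompRel M u v → MöbiusLadder.Edge N (H u) (H v)) →
  ∀ L → OddCycle M L → N < L
odd-cycle-longer-than M N H hom L@(suc _) (L-odd , _ , v , is-vertex , _ , adjacent) =
  odd-closed-walk-long L image steps (cong (H ∘ v) position-L) L-odd
  where
  open MöbiusLadder N
  open CyclicIndex L
  image : ℕ → ℕ
  image t = H (v (position t))
  edge : ∀ a b → Adj M (v a) (v b) → Edge (H (v a)) (H (v b))
  edge a b (inj₁ inc) = hom _ _ (is-vertex a) (is-vertex b) inc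
  edge a b (inj₂ inc) = Edge-sym (hom _ _ (is-vertex b) (is-vertex a) inc)
  steps : ∀ t → t < L → Edge (image t) (image (suc t))
  steps t t<L = edge _ _ (adjacent _ _ (consecutive t<L))

columns : ∀ {n} → Fin n × Fin n → ℕ × ℕ
columns (a , b) = toℕ a , toℕ b

-- A cyclic sequence of L pairs of column numbers below n, with consecutive pairs
-- (cyclically) related by R; `index` recovers the position of each pair, so the
-- pairs are distinct.
record CyclicSequence (n : ℕ) (R : ℕ × ℕ → ℕ × ℕ → Set) (L : ℕ) : Set where
  field
    pair     : ℕ → ℕ × ℕ
    index    : ℕ × ℕ → ℕ
    in-range : ∀ {a} → a < L → proj₁ (pair a) < n × proj₂ (pair a) < n
    proper   : ∀ {a} → a < L → proj₁ (pair a) ≢ proj₂ (pair a)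
    indexed  : ∀ {a} → a < L → index (pair a) ≡ a
    step     : ∀ {a} → suc a < L → R (pair a) (pair (suc a))
    closing  : R (pair (pred L)) (pair 0)

cycle : ∀ {m n} (M : BinMatrix m n) {R : ℕ × ℕ → ℕ × ℕ → Set} →
        (∀ {u v} → R (columns u) (columns v) → Adj M u v) →
        ∀ {L} → 3 ≤ L → CyclicSequence n R L → Cycle M L
cycle {n = n} M {R} R⇒Adj {L@(suc _)} 3≤L seq = 3≤L , v , is-vertex , injective , adjacent
  where
  open CyclicSequence seq
  v : Fin L → Fin n × Fin n
  v a = fromℕ< (proj₁ (in-range (toℕ<n a))) , fromℕ< (proj₂ (in-range (toℕ<n a)))
  columns-v : ∀ a → columns (v a) ≡ pair (toℕ a)
  columns-v a = cong₂ _,_ (toℕ-fromℕ< (proj₁ (in-range (toℕ<n a)))) (toℕ-fromℕ< (proj₂ (in-range (toℕ<n a))))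
  is-vertex : ∀ a → IsVertex (v a)
  is-vertex a e = proper (toℕ<n a)
    (trans (sym (cong proj₁ (columns-v a))) (trans (cong toℕ e) (cong proj₂ (columns-v a))))
  injective : ∀ {a b} → v a ≡ v b → a ≡ b
  injective {a} {b} e = toℕ-injective (begin
    toℕ a                       ≡⟨ indexed (toℕ<n a) ⟨
    index (pair (toℕ a))        ≡⟨ cong index (trans (sym (columns-v a)) (trans (cong columns e) (columns-v b))) ⟩
    index (pair (toℕ b))        ≡⟨ indexed (toℕ<n b) ⟩
    toℕ b                       ∎)
    where open ≡-Reasoning
  related : ∀ a b → R (pair (toℕ a)) (pair (toℕ b)) → Adj M (v a) (v b)
  related a b r = R⇒Adj (subst₂ R (sym (columns-v a)) (sym (columns-v b)) r)
  adjacent : ∀ a b → suc (toℕ a) ≡ toℕ b ⊎ (suc (toℕ a) ≡ L × toℕ b ≡ 0) → Adj M (v a) (v b)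
  adjacent a b (inj₁ a+1≡b) =
    related a b (subst (λ y → R (pair (toℕ a)) (pair y)) a+1≡b (step (subst (_< L) (sym a+1≡b) (toℕ<n b))))
  adjacent a b (inj₂ (a+1≡L , b≡0)) =
    related a b (subst₂ (λ x y → R (pair x) (pair y)) (sym (suc-injective a+1≡L)) (sym b≡0) closing)

-- From
-- here on k = 4 + P: the rows ρ < 2 + P are the path rows with support
-- {ρ , ρ + 1}, and row 2 + P is the last row, whose support among the k columns
-- is everything except columns 0 and 2 + P.
entry : ℕ → ℕ → ℕ → Bool
entry k ρ c =
  if ρ <ᵇ (k ∸ 2)
  then ((c ≡ᵇ ρ) ∨ (c ≡ᵇ suc ρ))
  else (((1 ≤ᵇ c) ∧ (c <ᵇ (k ∸ 2))) ∨ (c ≡ᵇ (k ∸ 1)))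

T-III-entry : ∀ k r c → T-III k r c ≡ entry k (toℕ r) (toℕ c)
T-III-entry k r c = refl

OnPath : ℕ → ℕ → Set
OnPath ρ c = c ≡ ρ ⊎ c ≡ suc ρ

beyond-path : ∀ {ρ c} → suc ρ < c → ¬ OnPath ρ c
beyond-path ρ+1<c (inj₁ refl) = <-asym ρ+1<c (n<1+n _)
beyond-path ρ+1<c (inj₂ refl) = <-irrefl refl ρ+1<c

before-path : ∀ {ρ c} → c < ρ → ¬ OnPath ρ c
before-path c<ρ (inj₁ refl) = <-irrefl refl c<ρ
before-path c<ρ (inj₂ refl) = <-asym c<ρ (n<1+n _)

-- The support of the last row (for columns below 4 + P), and its complement.
OnLast : ℕ → ℕ → Set
OnLast P c = c ≢ 0 × c ≢ 2 + P

OffLast : ℕ → ℕ → Set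
OffLast P c = c ≡ 0 ⊎ c ≡ 2 + P

off⇒¬on : ∀ {P c} → OffLast P c → ¬ OnLast P c
off⇒¬on (inj₁ c≡0)   (c≢0 , _)   = c≢0 c≡0
off⇒¬on (inj₂ c≡2+P) (_ , c≢2+P) = c≢2+P c≡2+P

on-path-row : ∀ P {ρ c} → ρ < 2 + P → entry (4 + P) ρ c ≡ true → OnPath ρ c
on-path-row P {ρ} {c} ρ<2+P e rewrite <⇒<ᵇ-true ρ<2+P with c ≡ᵇ ρ in c≡ρ
... | true  = inj₁ (≡ᵇ-sound c≡ρ)
... | false = inj₂ (≡ᵇ-sound e)

path-row-on : ∀ P {ρ c} → ρ < 2 + P → OnPath ρ c → entry (4 + P) ρ c ≡ true
path-row-on P {ρ} ρ<2+P (inj₁ refl) rewrite <⇒<ᵇ-true ρ<2+P | ≡ᵇ-refl ρ = refl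
path-row-on P {ρ} ρ<2+P (inj₂ refl) rewrite <⇒<ᵇ-true ρ<2+P | ≡ᵇ-refl ρ = ∨-zeroʳ (suc ρ ≡ᵇ ρ)

last-row : ∀ P c → entry (4 + P) (2 + P) c ≡ (((1 ≤ᵇ c) ∧ (c <ᵇ 2 + P)) ∨ (c ≡ᵇ 3 + P))
last-row P c rewrite ≥⇒<ᵇ-false (≤-refl {2 + P}) = refl

on-last-row : ∀ P {c} → entry (4 + P) (2 + P) c ≡ true → OnLast P c
on-last-row P {c} e = c≢0 , c≢2+P
  where
  c≢0 : c ≢ 0
  c≢0 refl with () ← trans (sym (last-row P 0)) e
  c≢2+P : c ≢ 2 + P
  c≢2+P refl with () ← trans (sym (trans (last-row P (2 + P))
    (cong₂ (λ a b → (true ∧ a) ∨ b) (≥⇒<ᵇ-false (≤-refl {2 + P})) (≢⇒≡ᵇ-false {P} (1+n≢n ∘ sym))))) e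

last-row-on : ∀ P {c} → c < 4 + P → OnLast P c → entry (4 + P) (2 + P) c ≡ true
last-row-on P {c} c<4+P (c≢0 , c≢2+P) rewrite last-row P c with c <? 2 + P
... | yes c<2+P rewrite to T-≡ (≤⇒≤ᵇ (n≢0⇒n>0 c≢0)) | <⇒<ᵇ-true c<2+P = refl
... | no c≮2+P rewrite ≤-antisym (<⇒≤pred c<4+P) (≤∧≢⇒< (≮⇒≥ c≮2+P) (c≢2+P ∘ sym)) | ≡ᵇ-refl P = ∨-zeroʳ _

data Incompatible (P i j l : ℕ) : Set where
  same-end     : i ≡ l → Incompatible P i j l
  via-path-row : ∀ ρ → ρ < 2 + P → OnPath ρ i → OnPath ρ l → ¬ OnPath ρ j → Incompatible P i j l
  via-last-row : OnLast P i → OnLast P l → OffLast P j → Incompatible P i j l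

true≢false : true ≢ false
true≢false ()

incompatible : ∀ P {i j l : Fin (4 + P)} → IncompRel (T-III (4 + P)) (i , j) (j , l) →
               Incompatible P (toℕ i) (toℕ j) (toℕ l)
incompatible P (_ , inj₁ refl) = same-end refl
incompatible P {i} {j} {l} (_ , inj₂ (r , i∈r , l∈r , j∉r)) with toℕ r <? 2 + P
... | yes ρ<2+P = via-path-row (toℕ r) ρ<2+P (on-path-row P ρ<2+P i∈r) (on-path-row P ρ<2+P l∈r)
                    (λ j∈ρ → true≢false (trans (sym (path-row-on P ρ<2+P j∈ρ)) j∉r))
... | no ρ≮2+P = via-last-row (on-last-row P (in-last-row (toℕ i) i∈r)) (on-last-row P (in-last-row (toℕ l) l∈r)) off
  where
  r≡2+P : toℕ r ≡ 2 + P
  r≡2+P = ≤-antisym (<⇒≤pred (toℕ<n r)) (≮⇒≥ ρ≮2+P)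
  in-last-row : ∀ c {b} → entry (4 + P) (toℕ r) c ≡ b → entry (4 + P) (2 + P) c ≡ b
  in-last-row c {b} = subst (λ ρ → entry (4 + P) ρ c ≡ b) r≡2+P
  off : OffLast P (toℕ j)
  off with toℕ j ≟ 0 | toℕ j ≟ 2 + P
  ... | yes j≡0 | _         = inj₁ j≡0
  ... | no _    | yes j≡2+P = inj₂ j≡2+P
  ... | no j≢0  | no j≢2+P  = contradiction
          (trans (sym (last-row-on P (toℕ<n j) (j≢0 , j≢2+P))) (in-last-row (toℕ j) j∉r))
          true≢false

entry-at : ∀ P ρ (ρ<3+P : ρ < 3 + P) (c : Fin (4 + P)) {b} → entry (4 + P) ρ (toℕ c) ≡ b →
           T-III (4 + P) (fromℕ< ρ<3+P) c ≡ b
entry-at P ρ ρ<3+P c e = trans (T-III-entry (4 + P) (fromℕ< ρ<3+P) c)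
  (subst (λ ρ′ → entry (4 + P) ρ′ (toℕ c) ≡ _) (sym (toℕ-fromℕ< ρ<3+P)) e)

incompatibility : ∀ P {i j l : Fin (4 + P)} → Incompatible P (toℕ i) (toℕ j) (toℕ l) →
                  IncompRel (T-III (4 + P)) (i , j) (j , l)
incompatibility P (same-end i≡l) = refl , inj₁ (toℕ-injective i≡l)
incompatibility P {i} {j} {l} (via-path-row ρ ρ<2+P i∈ρ l∈ρ j∉ρ) = refl , inj₂ (fromℕ< ρ<3+P ,
  entry-at P ρ ρ<3+P i (path-row-on P ρ<2+P i∈ρ) ,
  entry-at P ρ ρ<3+P l (path-row-on P ρ<2+P l∈ρ) ,
  entry-at P ρ ρ<3+P j (¬-not (j∉ρ ∘ on-path-row P ρ<2+P)))
  where
  ρ<3+P : ρ < 3 + P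
  ρ<3+P = m<n⇒m<1+n ρ<2+P
incompatibility P {i} {j} {l} (via-last-row i∈ l∈ j∉) = refl , inj₂ (fromℕ< last<3+P ,
  entry-at P (2 + P) last<3+P i (last-row-on P (toℕ<n i) i∈) ,
  entry-at P (2 + P) last<3+P l (last-row-on P (toℕ<n l) l∈) ,
  entry-at P (2 + P) last<3+P j (¬-not (off⇒¬on j∉ ∘ on-last-row P)))
  where
  last<3+P : 2 + P < 3 + P
  last<3+P = n<1+n (2 + P)

IncompatibleStep : ℕ → ℕ × ℕ → ℕ × ℕ → Set
IncompatibleStep P (i , j) (j′ , l) = j ≡ j′ × Incompatible P i j l

Adjacent : ℕ → ℕ × ℕ → ℕ × ℕ → Set
Adjacent P u v = IncompatibleStep P u v ⊎ IncompatibleStep P v u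

incompatible-step : ∀ P {u v : Fin (4 + P) × Fin (4 + P)} →
                    IncompatibleStep P (columns u) (columns v) → IncompRel (T-III (4 + P)) u v
incompatible-step P {_ , b} {c , _} (b≡c , inc) with toℕ-injective {i = b} {j = c} b≡c
... | refl = incompatibility P inc

adjacent : ∀ P {u v : Fin (4 + P) × Fin (4 + P)} →
           Adjacent P (columns u) (columns v) → Adj (T-III (4 + P)) u v
adjacent P (inj₁ step) = inj₁ (incompatible-step P step)
adjacent P (inj₂ step) = inj₂ (incompatible-step P step)

data ColumnView (P : ℕ) : ℕ → Set where
  low    : ∀ {j} → j ≤ P → ColumnView P j
  at-1+P : ColumnView P (1 + P)
  at-2+P : ColumnView P (2 + P)
  at-3+P : ColumnView P (3 + P)

column-view : ∀ P j → j < 4 + P → ColumnView P j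
column-view P j j<4+P with m≤n⇒m<n∨m≡n (<⇒≤pred j<4+P)
... | inj₂ refl = at-3+P
... | inj₁ j<3+P with m≤n⇒m<n∨m≡n (<⇒≤pred j<3+P)
... | inj₂ refl = at-2+P
... | inj₁ j<2+P with m≤n⇒m<n∨m≡n (<⇒≤pred j<2+P)
... | inj₂ refl = at-1+P
... | inj₁ j<1+P = low (<⇒≤pred j<1+P)

last-row-view : ∀ P {c} → c < 4 + P → OnLast P c → (0 < c × c < 2 + P) ⊎ c ≡ 3 + P
last-row-view P {c} c<4+P (c≢0 , c≢2+P) with column-view P c c<4+P
... | low c≤P = inj₁ (n≢0⇒n>0 c≢0 , m≤n⇒m≤1+n (s≤s c≤P))
... | at-1+P  = inj₁ (s≤s z≤n , n<1+n (1 + P))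
... | at-2+P  = contradiction refl c≢2+P
... | at-3+P  = inj₂ refl

-- The ladder order 2N that fits T_{III_{4+P}}: N = k + 1 for odd k, N = k + 2 for even k.
LadderSize : ℕ → ℕ → Set
LadderSize P N = (even P ≡ false × N ≡ 5 + P) ⊎ (even P ≡ true × N ≡ 6 + P)

module Homomorphism (P N : ℕ) .{{_ : NonZero N}} (size : LadderSize P N) where
  open MöbiusLadder N

  wrap : ∀ {x y} → x ≡ y + (N + N) → x ≋ y
  wrap e = ≋-trans (≡⇒≋ e) (+M≋ _)

  -- The image of an ascending pair (i , j), i < j, is determined by j and a little
  -- information on i; a descending pair goes to the antipode of its reversal.
  -- Along the zigzag, (i , 3+P) and (3+P , i) go to 4 + i and its antipode,
  -- according to the parity of i.
  lift : ℕ → ℕ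
  lift i = if even i then N else 0

  into-3+P : ℕ → ℕ
  into-3+P i = if i ≡ᵇ 2 + P then 0 else 4 + i + lift i

  into-2+P : ℕ → ℕ
  into-2+P zero    = 2 + N
  into-2+P (suc _) = 1

  into-1+P : ℕ → ℕ
  into-1+P zero    = 3
  into-1+P (suc _) = 2 + N

  ascending : ℕ → ℕ → ℕ
  ascending i j =
    if j ≡ᵇ 3 + P then into-3+P i
    else if j ≡ᵇ 2 + P then into-2+P i
    else if j ≡ᵇ 1 + P then into-1+P i
    else 3

  h : ℕ → ℕ → ℕ
  h i j = if i <ᵇ j then ascending i j else N + ascending j i

  ascending-3+P : ∀ i → ascending i (3 + P) ≡ into-3+P i
  ascending-3+P i rewrite ≡ᵇ-refl P = refl

  ascending-2+P : ∀ i → ascending i (2 + P) ≡ into-2+P i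
  ascending-2+P i rewrite ≢⇒≡ᵇ-false {P} (1+n≢n ∘ sym) | ≡ᵇ-refl P = refl

  ascending-1+P : ∀ i → ascending i (1 + P) ≡ into-1+P i
  ascending-1+P i rewrite ≢⇒≡ᵇ-false {P} {2 + P} (<⇒≢ (m≤n⇒m≤1+n (n<1+n P)))
                        | ≢⇒≡ᵇ-false {P} (1+n≢n ∘ sym) | ≡ᵇ-refl P = refl

  ascending-low : ∀ i {j} → j ≤ P → ascending i j ≡ 3
  ascending-low i {j} j≤P
    rewrite ≢⇒≡ᵇ-false {j} {3 + P} (<⇒≢ (s≤s (m≤n⇒m≤1+n (m≤n⇒m≤1+n j≤P))))
          | ≢⇒≡ᵇ-false {j} {2 + P} (<⇒≢ (s≤s (m≤n⇒m≤1+n j≤P)))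
          | ≢⇒≡ᵇ-false {j} {1 + P} (<⇒≢ (s≤s j≤P)) = refl

  into-3+P-2+P : into-3+P (2 + P) ≡ 0
  into-3+P-2+P rewrite ≡ᵇ-refl P = refl

  into-3+P-path : ∀ {i} → i < 2 + P → into-3+P i ≡ 4 + i + lift i
  into-3+P-path i<2+P rewrite ≢⇒≡ᵇ-false (<⇒≢ i<2+P) = refl

  h-ascending : ∀ {i j} → i < j → h i j ≡ ascending i j
  h-ascending i<j rewrite <⇒<ᵇ-true i<j = refl

  h-descending : ∀ {i j} → j < i → h i j ≡ N + ascending j i
  h-descending j<i rewrite ≥⇒<ᵇ-false (<⇒≤ j<i) = refl

  h-reverse : ∀ {i j} → i ≢ j → h j i ≋ h i j + N
  h-reverse {i} {j} i≢j with <-cmp i j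
  ... | tri< i<j _ _ rewrite h-ascending i<j | h-descending i<j = ≡⇒≋ (+-comm N _)
  ... | tri≈ _ i≡j _ = contradiction i≡j i≢j
  ... | tri> _ _ j<i rewrite h-ascending j<i | h-descending j<i =
          ≋-sym (≋-trans (≡⇒≋ (cong (_+ N) (+-comm N _))) (+N+N≋ _))

  to-antipode : ∀ x → Edge x (N + x)
  to-antipode x = antipodal (≡⇒≋ (+-comm N x))

  from-antipode : ∀ x → Edge (N + x) x
  from-antipode x = Edge-sym (to-antipode x)

  zigzag-step : ∀ ρ → Edge (4 + ρ + lift ρ) (N + (4 + suc ρ + lift (suc ρ)))
  zigzag-step ρ with even ρ
  ... | true  = forward (≡⇒≋ (regroup N ρ))
    where
    regroup : ∀ n r → n + (5 + r + 0) ≡ suc (4 + r + n)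
    regroup = solve-∀
  ... | false = forward (wrap (regroup N ρ))
    where
    regroup : ∀ n r → n + (5 + r + n) ≡ suc (4 + r + 0) + (n + n)
    regroup = solve-∀

  lift-after-even : ∀ {i} → even i ≡ true → lift (suc i) ≡ 0
  lift-after-even e = cong (λ b → if not b then N else 0) e

  lift-after-odd : ∀ {i} → even i ≡ false → lift (suc i) ≡ N
  lift-after-odd e = cong (λ b → if not b then N else 0) e

  -- The step (1+P , 3+P) → (3+P , 2+P) is the one place where the parity of P
  -- and the exact value of N enter.
  parity-step : LadderSize P N → Edge (4 + suc P + lift (suc P)) (N + 0)
  parity-step (inj₁ (P-odd , N≡5+P)) = antipodal (≋-sym (wrap (begin
    4 + suc P + lift (suc P) + N   ≡⟨ cong (λ t → 5 + P + t + N) (lift-after-odd {P} P-odd) ⟩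
    5 + P + N + N                  ≡⟨ cong (λ t → t + N + N) (sym N≡5+P) ⟩
    N + N + N                      ≡⟨ solve (N ∷ []) ⟩
    N + 0 + (N + N)                ∎)))
    where open ≡-Reasoning
  parity-step (inj₂ (P-even , N≡6+P)) = forward (≡⇒≋ (begin
    N + 0                          ≡⟨ +-identityʳ N ⟩
    N                              ≡⟨ N≡6+P ⟩
    6 + P                          ≡⟨ cong (6 +_) (sym (+-identityʳ P)) ⟩
    6 + (P + 0)                    ≡⟨ cong (λ t → 6 + (P + t)) (sym (lift-after-even {P} P-even)) ⟩
    suc (4 + suc P + lift (suc P)) ∎))
    where open ≡-Reasoning

  path-step-above : ∀ {ρ j} → ρ < 2 + P → ColumnView P j →
                    Edge (ascending ρ j) (N + ascending (suc ρ) j)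
  path-step-above {ρ} _ (low j≤P)
    rewrite ascending-low ρ j≤P | ascending-low (suc ρ) j≤P = to-antipode 3
  path-step-above {zero} _ at-1+P
    rewrite ascending-1+P 0 | ascending-1+P 1 = backward (≋-sym (wrap (solve (N ∷ []))))
  path-step-above {suc ρ} _ at-1+P
    rewrite ascending-1+P (suc ρ) | ascending-1+P (suc (suc ρ)) = to-antipode (2 + N)
  path-step-above {zero} _ at-2+P
    rewrite ascending-2+P 0 | ascending-2+P 1 = backward (≡⇒≋ (solve (N ∷ [])))
  path-step-above {suc ρ} _ at-2+P
    rewrite ascending-2+P (suc ρ) | ascending-2+P (suc (suc ρ)) = to-antipode 1
  path-step-above {ρ} ρ<2+P at-3+P
    rewrite ascending-3+P ρ | ascending-3+P (suc ρ) | into-3+P-path ρ<2+P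
    with m≤n⇒m<n∨m≡n (<⇒≤pred ρ<2+P)
  ... | inj₁ ρ<1+P rewrite into-3+P-path (s≤s ρ<1+P) = zigzag-step ρ
  ... | inj₂ refl  rewrite into-3+P-2+P = parity-step size

  path-step-below : ∀ {ρ j} → ρ < 2 + P → ColumnView P (suc ρ) →
                    Edge (N + ascending j ρ) (ascending j (suc ρ))
  path-step-below {ρ} {j} _ (low ρ<P)
    rewrite ascending-low j (<⇒≤ ρ<P) | ascending-low j ρ<P = from-antipode 3
  path-step-below {_} {zero} _ at-1+P
    rewrite ascending-low 0 (≤-refl {P}) | ascending-1+P 0 = from-antipode 3
  path-step-below {_} {suc j} _ at-1+P
    rewrite ascending-low (suc j) (≤-refl {P}) | ascending-1+P (suc j) = backward (≡⇒≋ (solve (N ∷ [])))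
  path-step-below {_} {zero} _ at-2+P
    rewrite ascending-1+P 0 | ascending-2+P 0 = backward (≡⇒≋ (solve (N ∷ [])))
  path-step-below {_} {suc j} _ at-2+P
    rewrite ascending-1+P (suc j) | ascending-2+P (suc j) = backward (wrap (solve (N ∷ [])))
  path-step-below ρ<2+P at-3+P = contradiction ρ<2+P (<-irrefl refl)

  path-step : ∀ {ρ j} → ρ < 2 + P → j < 4 + P → ¬ OnPath ρ j →
              Edge (h ρ j) (h j (suc ρ))
  path-step {ρ} {j} ρ<2+P j<4+P j∉ρ with <-cmp j ρ
  ... | tri< j<ρ _ _ rewrite h-descending j<ρ | h-ascending (m<n⇒m<1+n j<ρ) =
          path-step-below {ρ} {j} ρ<2+P (column-view P (suc ρ) (s≤s (m<n⇒m<1+n ρ<2+P)))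
  ... | tri≈ _ j≡ρ _ = contradiction (inj₁ j≡ρ) j∉ρ
  ... | tri> _ _ ρ<j rewrite h-ascending ρ<j | h-descending (≤∧≢⇒< ρ<j (j∉ρ ∘ inj₂ ∘ sym)) =
          path-step-above ρ<2+P (column-view P j j<4+P)

  reverse-step : ∀ {i j l} → i ≢ j → j ≢ l → Edge (h i j) (h j l) → Edge (h l j) (h j i)
  reverse-step i≢j j≢l e =
    Edge-resp (≋-sym (h-reverse j≢l)) (≋-sym (h-reverse i≢j)) (Edge-+N (Edge-sym e))

  same-end-step : ∀ {i j} → i ≢ j → Edge (h i j) (h j i)
  same-end-step i≢j = antipodal (h-reverse i≢j)

  ascending-from-0 : ∀ {c} → 0 < c → c < 2 + P → ascending 0 c ≡ 3
  ascending-from-0 {c} _ c<2+P with m≤n⇒m<n∨m≡n (<⇒≤pred c<2+P)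
  ... | inj₁ c<1+P = ascending-low 0 (<⇒≤pred c<1+P)
  ... | inj₂ refl  = ascending-1+P 0

  last-row-step-0 : ∀ {i l} → (0 < i × i < 2 + P) ⊎ i ≡ 3 + P →
                    (0 < l × l < 2 + P) ⊎ l ≡ 3 + P → Edge (h i 0) (h 0 l)
  last-row-step-0 (inj₁ (0<i , i<2+P)) (inj₁ (0<l , l<2+P))
    rewrite h-descending 0<i | h-ascending 0<l | ascending-from-0 0<i i<2+P | ascending-from-0 0<l l<2+P =
      from-antipode 3
  last-row-step-0 (inj₂ refl) (inj₁ (0<l , l<2+P))
    rewrite h-descending (s≤s (z≤n {3 + P})) | h-ascending 0<l | ascending-from-0 0<l l<2+P
          | ascending-3+P 0 | into-3+P-path (s≤s (z≤n {1 + P})) =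
      backward (wrap (solve (N ∷ [])))
  last-row-step-0 (inj₁ (0<i , i<2+P)) (inj₂ refl)
    rewrite h-descending 0<i | h-ascending (s≤s (z≤n {3 + P})) | ascending-from-0 0<i i<2+P
          | ascending-3+P 0 | into-3+P-path (s≤s (z≤n {1 + P})) =
      forward (≡⇒≋ (solve (N ∷ [])))
  last-row-step-0 (inj₂ refl) (inj₂ refl) = same-end-step {3 + P} {0} (λ ())

  last-row-step-2+P : ∀ {i l} → (0 < i × i < 2 + P) ⊎ i ≡ 3 + P →
                      (0 < l × l < 2 + P) ⊎ l ≡ 3 + P → Edge (h i (2 + P)) (h (2 + P) l)
  last-row-step-2+P {suc i} {suc l} (inj₁ (_ , i<2+P)) (inj₁ (_ , l<2+P))
    rewrite h-ascending i<2+P | h-descending l<2+P | ascending-2+P (suc i) | ascending-2+P (suc l) =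
      to-antipode 1
  last-row-step-2+P {_} {suc l} (inj₂ refl) (inj₁ (_ , l<2+P))
    rewrite h-descending (n<1+n (2 + P)) | h-descending l<2+P | ascending-3+P (2 + P) | into-3+P-2+P
          | ascending-2+P (suc l) =
      forward (≡⇒≋ (solve (N ∷ [])))
  last-row-step-2+P {suc i} (inj₁ (_ , i<2+P)) (inj₂ refl)
    rewrite h-ascending i<2+P | h-ascending (n<1+n (2 + P)) | ascending-3+P (2 + P) | into-3+P-2+P
          | ascending-2+P (suc i) =
      backward ≋-refl
  last-row-step-2+P (inj₂ refl) (inj₂ refl) = same-end-step {3 + P} {2 + P} 1+n≢n

  homomorphism : ∀ {i j l} → i < 4 + P → j < 4 + P → l < 4 + P →
                 i ≢ j → j ≢ l → Incompatible P i j l → Edge (h i j) (h j l)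
  homomorphism _ _ _ i≢j _ (same-end refl) = same-end-step i≢j
  homomorphism _ j<4+P _ _ _ (via-path-row ρ ρ<2+P (inj₁ refl) (inj₂ refl) j∉ρ) =
    path-step ρ<2+P j<4+P j∉ρ
  homomorphism _ j<4+P _ i≢j j≢l (via-path-row ρ ρ<2+P (inj₂ refl) (inj₁ refl) j∉ρ) =
    reverse-step (j≢l ∘ sym) (i≢j ∘ sym) (path-step ρ<2+P j<4+P j∉ρ)
  homomorphism _ _ _ i≢j _ (via-path-row _ _ (inj₁ refl) (inj₁ refl) _) = same-end-step i≢j
  homomorphism _ _ _ i≢j _ (via-path-row _ _ (inj₂ refl) (inj₂ refl) _) = same-end-step i≢j
  homomorphism i<4+P _ l<4+P _ _ (via-last-row i∈ l∈ (inj₁ refl)) =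
    last-row-step-0 (last-row-view P i<4+P i∈) (last-row-view P l<4+P l∈)
  homomorphism i<4+P _ l<4+P _ _ (via-last-row i∈ l∈ (inj₂ refl)) =
    last-row-step-2+P (last-row-view P i<4+P i∈) (last-row-view P l<4+P l∈)

odd-cycles-longer : ∀ P N .{{_ : NonZero N}} → LadderSize P N →
                    ∀ L → OddCycle (T-III (4 + P)) L → N < L
odd-cycles-longer P N size = odd-cycle-longer-than (T-III (4 + P)) N H H-homomorphism
  where
  open Homomorphism P N size
  H : Fin (4 + P) × Fin (4 + P) → ℕ
  H (a , b) = h (toℕ a) (toℕ b)
  H-homomorphism : ∀ u v → IsVertex u → IsVertex v → IncompRel (T-III (4 + P)) u v →
                   MöbiusLadder.Edge N (H u) (H v)
  H-homomorphism (a , b) (_ , c) a≢b b≢c (refl , r) =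
    homomorphism (toℕ<n a) (toℕ<n b) (toℕ<n c) (a≢b ∘ toℕ-injective) (b≢c ∘ toℕ-injective)
      (incompatible P (refl , r))

module ShortOddCycle (P : ℕ) where

  -- The zigzag (3+P , 0), (1 , 3+P), (3+P , 2), (3 , 3+P), … alternates between
  -- the last column and the path columns 0 … 2+P; consecutive pairs are joined
  -- through the path rows.
  zigzag : ℕ → ℕ × ℕ
  zigzag a = if even a then (3 + P , a) else (a , 3 + P)

  zigzag-step : ∀ {a} → suc a < 3 + P → Adjacent P (zigzag a) (zigzag (suc a))
  zigzag-step {a} a+1<3+P with even a
  ... | true  = inj₂ (refl , via-path-row a (<⇒≤pred a+1<3+P) (inj₂ refl) (inj₁ refl) (beyond-path a+1<3+P))
  ... | false = inj₁ (refl , via-path-row a (<⇒≤pred a+1<3+P) (inj₁ refl) (inj₂ refl) (beyond-path a+1<3+P))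

  -- The finish leads from column 2+P back to the start (3+P , 0) of the zigzag.
  finish : ℕ → ℕ × ℕ
  finish 0 = 1 , 2 + P
  finish 1 = 2 + P , 0
  finish _ = 0 , 1 + P

  -- The front: the zigzag over the columns 0 … 2+P, then the pair (2+P , 3+P)
  -- (with which the zigzag itself ends when P is odd).
  front : ℕ → ℕ × ℕ
  front a = if a <ᵇ 3 + P then zigzag a else (2 + P , 3 + P)

  walk : ℕ → ℕ → ℕ × ℕ
  walk ℓ a = if a <ᵇ ℓ then front a else finish (a ∸ ℓ)

  -- Positions of the pairs of the walk (a left inverse of `walk ℓ`).
  index : ℕ → ℕ × ℕ → ℕ
  index ℓ (x , y) =
    if x ≡ᵇ 3 + P then y
    else if y ≡ᵇ 3 + P then (if x ≡ᵇ 2 + P then ℓ ∸ 1 else x)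
    else if x ≡ᵇ 1 then ℓ
    else if x ≡ᵇ 0 then 2 + ℓ
    else 1 + ℓ

  -- The front has length ℓ = N ∸ 2: 3 + P for odd P and 4 + P for even P.
  FrontLength : ℕ → Set
  FrontLength ℓ = LadderSize P (2 + ℓ)

  front-zigzag : ∀ {a} → a < 3 + P → front a ≡ zigzag a
  front-zigzag a<3+P rewrite <⇒<ᵇ-true a<3+P = refl

  front-turn : front (3 + P) ≡ (2 + P , 3 + P)
  front-turn rewrite ≥⇒<ᵇ-false (≤-refl {3 + P}) = refl

  walk-front : ∀ {ℓ a} → a < ℓ → walk ℓ a ≡ front a
  walk-front a<ℓ rewrite <⇒<ᵇ-true a<ℓ = refl

  walk-finish : ∀ ℓ e → walk ℓ (e + ℓ) ≡ finish e
  walk-finish ℓ e rewrite ≥⇒<ᵇ-false (m≤n+m ℓ e) | m+n∸n≡m e ℓ = refl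

  zigzag-in-range : ∀ {a} → a < 3 + P → proj₁ (zigzag a) < 4 + P × proj₂ (zigzag a) < 4 + P
  zigzag-in-range {a} a<3+P with even a
  ... | true  = n<1+n (3 + P) , m<n⇒m<1+n a<3+P
  ... | false = m<n⇒m<1+n a<3+P , n<1+n (3 + P)

  zigzag-proper : ∀ {a} → a < 3 + P → proj₁ (zigzag a) ≢ proj₂ (zigzag a)
  zigzag-proper {a} a<3+P with even a
  ... | true  = <⇒≢ a<3+P ∘ sym
  ... | false = <⇒≢ a<3+P

  front-in-range : ∀ a → proj₁ (front a) < 4 + P × proj₂ (front a) < 4 + P
  front-in-range a with a <? 3 + P
  ... | yes a<3+P rewrite front-zigzag a<3+P = zigzag-in-range a<3+P
  ... | no a≮3+P rewrite ≥⇒<ᵇ-false (≮⇒≥ a≮3+P) = m<n⇒m<1+n (n<1+n (2 + P)) , n<1+n (3 + P)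

  front-proper : ∀ a → proj₁ (front a) ≢ proj₂ (front a)
  front-proper a with a <? 3 + P
  ... | yes a<3+P rewrite front-zigzag a<3+P = zigzag-proper a<3+P
  ... | no a≮3+P rewrite ≥⇒<ᵇ-false (≮⇒≥ a≮3+P) = 1+n≢n ∘ sym

  finish-in-range : ∀ e → proj₁ (finish e) < 4 + P × proj₂ (finish e) < 4 + P
  finish-in-range 0 = s≤s (s≤s z≤n) , m<n⇒m<1+n (n<1+n (2 + P))
  finish-in-range 1 = m<n⇒m<1+n (n<1+n (2 + P)) , s≤s z≤n
  finish-in-range (suc (suc _)) = s≤s z≤n , m<n⇒m<1+n (m<n⇒m<1+n (n<1+n (1 + P)))

  finish-proper : ∀ e → proj₁ (finish e) ≢ proj₂ (finish e)
  finish-proper 0 ()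
  finish-proper 1 ()
  finish-proper (suc (suc _)) ()

  last≢2+P : 3 + P ≢ 2 + P
  last≢2+P = 1+n≢n

  front-indexed : ∀ {ℓ a} → FrontLength ℓ → a < ℓ → index ℓ (front a) ≡ a
  front-indexed {ℓ} {a} fl a<ℓ with a <? 3 + P
  ... | yes a<3+P rewrite front-zigzag a<3+P with even a in parity
  ...   | true rewrite ≡ᵇ-refl P = refl
  ...   | false rewrite ≢⇒≡ᵇ-false (<⇒≢ a<3+P) | ≡ᵇ-refl P with a ≟ 2 + P
  ...     | no a≢2+P rewrite ≢⇒≡ᵇ-false a≢2+P = refl
  ...     | yes refl rewrite ≡ᵇ-refl P with fl
  ...       | inj₁ (_ , refl) = refl
  ...       | inj₂ (P-even , _) = contradiction (trans (sym P-even) (trans (sym (even-2+ P)) parity)) λ ()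
  front-indexed {ℓ} {a} fl a<ℓ | no a≮3+P with fl
  ... | inj₁ (_ , refl) = contradiction a<ℓ a≮3+P
  ... | inj₂ (_ , refl) rewrite ≤-antisym (<⇒≤pred a<ℓ) (≮⇒≥ a≮3+P) | front-turn
                              | ≢⇒≡ᵇ-false (last≢2+P ∘ sym) | ≡ᵇ-refl P = refl

  finish-indexed : ∀ ℓ e → e < 3 → index ℓ (finish e) ≡ e + ℓ
  finish-indexed ℓ 0 _ rewrite ≢⇒≡ᵇ-false (last≢2+P ∘ sym) = refl
  finish-indexed ℓ 1 _ rewrite ≢⇒≡ᵇ-false (last≢2+P ∘ sym) = refl
  finish-indexed ℓ 2 _ rewrite ≢⇒≡ᵇ-false {1 + P} {3 + P} (<⇒≢ (m<n⇒m<1+n (n<1+n (1 + P)))) = refl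
  finish-indexed ℓ (suc (suc (suc _))) (s≤s (s≤s (s≤s ())))

  last-on-last : OnLast P (3 + P)
  last-on-last = (λ ()) , last≢2+P

  front-step : ∀ {ℓ a} → FrontLength ℓ → suc a < ℓ → Adjacent P (front a) (front (suc a))
  front-step {ℓ} {a} fl a+1<ℓ with suc a <? 3 + P
  ... | yes a+1<3+P rewrite front-zigzag (<-trans (n<1+n a) a+1<3+P) | front-zigzag a+1<3+P =
          zigzag-step a+1<3+P
  ... | no a+1≮3+P with fl
  ...   | inj₁ (_ , refl) = contradiction a+1<ℓ a+1≮3+P
  ...   | inj₂ (P-even , refl) rewrite suc-injective (≤-antisym (<⇒≤pred a+1<ℓ) (≮⇒≥ a+1≮3+P))
                                     | front-zigzag (n<1+n (2 + P)) | front-turn | even-2+ P | P-even =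
          inj₁ (refl , same-end refl)

  front-last : ∀ {ℓ} → FrontLength ℓ → front (ℓ ∸ 1) ≡ (2 + P , 3 + P)
  front-last (inj₁ (P-odd , refl)) rewrite front-zigzag (n<1+n (2 + P)) | even-2+ P | P-odd = refl
  front-last (inj₂ (_ , refl)) = front-turn

  junction : Adjacent P (2 + P , 3 + P) (finish 0)
  junction = inj₂ (refl , via-last-row ((λ ()) , λ ()) last-on-last (inj₂ refl))

  finish-step : ∀ e → suc e < 3 → Adjacent P (finish e) (finish (suc e))
  finish-step 0 _ = inj₁ (refl , via-path-row 0 (s≤s z≤n) (inj₂ refl) (inj₁ refl) (beyond-path (s≤s (s≤s z≤n))))
  finish-step 1 _ = inj₁ (refl , via-path-row (1 + P) (n<1+n (1 + P)) (inj₂ refl) (inj₁ refl) (before-path (s≤s z≤n)))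
  finish-step (suc (suc _)) (s≤s (s≤s (s≤s ())))

  closing-step : Adjacent P (finish 2) (3 + P , 0)
  closing-step = inj₂ (refl , via-last-row last-on-last ((λ ()) , <⇒≢ (n<1+n (1 + P))) (inj₁ refl))

  data Part (ℓ a : ℕ) : Set where
    in-front  : a < ℓ → Part ℓ a
    in-finish : ∀ e → e < 3 → a ≡ e + ℓ → Part ℓ a

  part : ∀ ℓ {a} → a < 3 + ℓ → Part ℓ a
  part ℓ {a} a<3+ℓ with a <? ℓ
  ... | yes a<ℓ = in-front a<ℓ
  ... | no a≮ℓ  = in-finish (a ∸ ℓ)
                    (subst (a ∸ ℓ <_) (m+n∸n≡m 3 ℓ) (∸-monoˡ-< a<3+ℓ (≮⇒≥ a≮ℓ)))
                    (sym (m∸n+n≡m (≮⇒≥ a≮ℓ)))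

  walk-step : ∀ {ℓ} → FrontLength ℓ → ∀ {a} → suc a < 3 + ℓ → Adjacent P (walk ℓ a) (walk ℓ (suc a))
  walk-step {ℓ} fl {a} a+1<L with part ℓ (<-trans (n<1+n a) a+1<L)
  ... | in-finish 0 _ refl rewrite walk-finish ℓ 0 | walk-finish ℓ 1 = finish-step 0 (s≤s (s≤s z≤n))
  ... | in-finish 1 _ refl rewrite walk-finish ℓ 1 | walk-finish ℓ 2 = finish-step 1 (s≤s (s≤s (s≤s z≤n)))
  ... | in-finish (suc (suc e)) _ refl = contradiction (s≤s (s≤s (s≤s (m≤n+m ℓ e)))) (<⇒≱ a+1<L)
  ... | in-front a<ℓ with suc a <? ℓ
  ...   | yes a+1<ℓ rewrite walk-front a<ℓ | walk-front a+1<ℓ = front-step fl a+1<ℓ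
  ...   | no a+1≮ℓ with ≤-antisym a<ℓ (≮⇒≥ a+1≮ℓ)
  ...     | refl rewrite walk-front a<ℓ | walk-finish (suc a) 0 =
            subst (λ u → Adjacent P u (finish 0)) (sym (front-last fl)) junction

  walk-in-range : ∀ {ℓ a} → a < 3 + ℓ → proj₁ (walk ℓ a) < 4 + P × proj₂ (walk ℓ a) < 4 + P
  walk-in-range {ℓ} {a} a<L with part ℓ a<L
  ... | in-front a<ℓ rewrite walk-front a<ℓ = front-in-range a
  ... | in-finish e _ refl rewrite walk-finish ℓ e = finish-in-range e

  walk-proper : ∀ {ℓ a} → a < 3 + ℓ → proj₁ (walk ℓ a) ≢ proj₂ (walk ℓ a)
  walk-proper {ℓ} {a} a<L with part ℓ a<L
  ... | in-front a<ℓ rewrite walk-front a<ℓ = front-proper a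
  ... | in-finish e _ refl rewrite walk-finish ℓ e = finish-proper e

  walk-indexed : ∀ {ℓ} → FrontLength ℓ → ∀ {a} → a < 3 + ℓ → index ℓ (walk ℓ a) ≡ a
  walk-indexed {ℓ} fl a<L with part ℓ a<L
  ... | in-front a<ℓ rewrite walk-front a<ℓ = front-indexed fl a<ℓ
  ... | in-finish e e<3 refl rewrite walk-finish ℓ e = finish-indexed ℓ e e<3

  front-nonempty : ∀ {ℓ} → FrontLength ℓ → 0 < ℓ
  front-nonempty (inj₁ (_ , refl)) = s≤s z≤n
  front-nonempty (inj₂ (_ , refl)) = s≤s z≤n

  walk-closing : ∀ {ℓ} → FrontLength ℓ → Adjacent P (walk ℓ (2 + ℓ)) (walk ℓ 0)
  walk-closing {ℓ} fl rewrite walk-finish ℓ 2 | walk-front {ℓ} {0} (front-nonempty fl) = closing-step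

  short-cycle : ∀ {ℓ} → FrontLength ℓ → Cycle (T-III (4 + P)) (3 + ℓ)
  short-cycle {ℓ} fl = cycle (T-III (4 + P)) {Adjacent P} (adjacent P) (s≤s (s≤s (s≤s z≤n))) (record
    { pair     = walk ℓ
    ; index    = index ℓ
    ; in-range = walk-in-range
    ; proper   = walk-proper
    ; indexed  = walk-indexed fl
    ; step     = walk-step fl
    ; closing  = walk-closing fl
    })

smallest-odd-cycle : ∀ P ℓ → LadderSize P (2 + ℓ) → Odd (3 + ℓ) →
                     SmallestOddCycleLength (T-III (4 + P)) (3 + ℓ)
smallest-odd-cycle P ℓ size odd =
  (odd , ShortOddCycle.short-cycle P size) , odd-cycles-longer P (2 + ℓ) size

lemma3p4 : (k : ℕ) → 4 ≤ k →
    (Odd k → SmallestOddCycleLength (T-III k) (k + 2)) ×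
    (Even k → SmallestOddCycleLength (T-III k) (k + 3))
lemma3p4 .(4 + P) (s≤s (s≤s (s≤s (s≤s {n = P} _)))) = odd-k , even-k
  where
  odd-k : Odd (4 + P) → SmallestOddCycleLength (T-III (4 + P)) (4 + P + 2)
  odd-k k-odd = subst (SmallestOddCycleLength (T-III (4 + P))) (cong (4 +_) (+-comm 2 P))
    (smallest-odd-cycle P (3 + P) (inj₁ (trans (sym (even-4+ P)) (even-false k-odd) , refl)) (odd+2 k-odd))
  even-k : Even (4 + P) → SmallestOddCycleLength (T-III (4 + P)) (4 + P + 3)
  even-k k-even = subst (SmallestOddCycleLength (T-III (4 + P))) (cong (4 +_) (+-comm 3 P))
    (smallest-odd-cycle P (4 + P) (inj₂ (trans (sym (even-4+ P)) (even-true k-even) , refl)) (even+3 k-even))
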